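{- There is a function $\varepsilon:\mathbb{N}\to\mathbb{R}$ with $\varepsilon(d)\to 0$ as $d\to\infty$ such that for every additive set $A$ (a finite subset of an abelian group $G$) with $d_d(A)\geq 2$, \[ \frac{d_s^-(A)}{d_d(A)}\;\geq\;\frac{1}{\log_4 d_d(A)}\,\big(1+\varepsilon(d_d(A))\big). \] That is, $\frac{d_s^-(A)}{d_d(A)}\geq \frac{1}{\log_4 d_d(A)}(1+o(1))$ as $d_d(A)\to\infty$.
   Context: An additive set is a finite subset $A$ of an abelian group $G$. A set $D$ in an abelian group is dissociated if its subset sums $\sum_{x\in D'}x$ ($D'\subset D$) are pairwise distinct; equivalently the only combination $\sum_{x\in D}\varepsilon_x x$ with $\varepsilon_x\in\{ -1,0,1\}$ equal to $0$ is the trivial one. The dissociativity dimension is $d_d(A)=\max\{|D|: D\subset A \text{ dissociated}\}$. For $S\subset G$, the 1-span $\langle S\rangle$ is the set of all sums $\sum_{s\in S}\varepsilon_s s$ with $\varepsilon_s\in\{ -1,0,1\}$. The lower 1-span dimension is $d_s^-(A)=\min\{|S|: S\subset G,\ \langle S\rangle\supset A\}$, where $G$ is the ambient group of $A$. -}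

module Defs where

open import Level using (Level; _⊔_)
open import Algebra.Bundles using (AbelianGroup)
open import Data.Nat using (ℕ; _≤_)
open import Data.Fin using (Fin; zero; suc)
open import Data.List using (List; []; _∷_; length)
open import Data.List.Relation.Unary.All using (All)
open import Data.List.Relation.Unary.Any using (Any)
open import Data.Product using (Σ; ∃; _×_)
open import Relation.Binary.PropositionalEquality using (_≡_)

data Sign : Set where
  neg zer pos : Sign

module AdditiveSets {c ℓ : Level} (G : AbelianGroup c ℓ) where
  open AbelianGroup G renaming (Carrier to El)

  act : Sign → El → El
  act neg x = x ⁻¹
  act zer x = ε
  act pos x = x

  signedSum : (xs : List El) → (Fin (length xs) → Sign) → El
  signedSum []       e = ε
  signedSum (x ∷ xs) e = act (e zero) x ∙ signedSum xs (λ i → e (suc i))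

  _∈_ : El → List El → Set (c ⊔ ℓ)
  x ∈ xs = Any (λ y → x ≈ y) xs

  _⊆_ : List El → List El → Set (c ⊔ ℓ)
  xs ⊆ ys = All (λ x → x ∈ ys) xs

  -- dissociated: the only {-1,0,1}-combination equal to 0 is the trivial one
  -- (a list with a repeated element is automatically not dissociated)
  Dissociated : List El → Set ℓ
  Dissociated D = (e : Fin (length D) → Sign) → signedSum D e ≈ ε → (i : Fin (length D)) → e i ≡ zer

  InSpan : List El → El → Set ℓ
  InSpan S g = Σ (Fin (length S) → Sign) (λ e → signedSum S e ≈ g)

  Spans : List El → List El → Set (c ⊔ ℓ)
  Spans S A = All (InSpan S) A

  IsDissDim : List El → ℕ → Set (c ⊔ ℓ)
  IsDissDim A d =
    (∃ λ D → D ⊆ A × Dissociated D × length D ≡ d) ×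
    ((D : List El) → D ⊆ A → Dissociated D → length D ≤ d)

{-# OPTIONS --safe #-}
module Submission where

-- Let D ⊆ A be dissociated with |D| = d, and let ⟨S⟩ ⊇ A with |S| = s. Writing each element of
-- D as a {-1,0,1}-combination of S yields sign vectors E₁, …, E_d ∈ ℤˢ which are again
-- dissociated, so the 2ᵈ sums Σᵢ ±Eᵢ are distinct lattice points. Their mean squared norm is
-- Σᵢ ‖Eᵢ‖² ≤ ds, so by Markov at least half of them lie in the ball ‖x‖² ≤ 2ds ≤ 2r²s, where
-- d ≤ r² ≤ 4d. Weighting a lattice point x by ∏ⱼ 2^(-⌊|xⱼ|/r⌋) shows that this ball contains at
-- most (16r)ˢ of them. Hence 4ᵈ ≤ 4(1024d)ˢ, which for d ≥ 4096ᵏ gives 4^(kd) ≤ d^((k+1)s).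

open import Defs
open import Level using (Level)
open import Algebra.Bundles using (AbelianGroup)
import Algebra.Properties.CommutativeMonoid.Sum as CommutativeMonoidSum
open import Data.Bool using (Bool; true; false)
open import Data.Empty using (⊥-elim)
open import Data.Fin using (Fin; zero; suc)
open import Data.Integer as ℤ using (ℤ; +_; 0ℤ; 1ℤ; -1ℤ)
import Data.Integer.Properties as ℤP
import Data.Integer.Tactic.RingSolver as ℤSolver
open import Data.List as List
  using (List; []; _∷_; _++_; length; lookup; map; filter; cartesianProductWith; upTo; downFrom)
import Data.List.Properties as ListP
open import Data.List.Membership.Propositional using () renaming (_∈_ to _∈ₚ_)
open import Data.List.Membership.Propositional.Properties
  using (∈-lookup; ∈-cartesianProductWith⁺; ∈-downFrom⁺; ∈-downFrom⁻; ∈-upTo⁺)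
open import Data.List.Relation.Unary.All as All using (All; []; _∷_)
import Data.List.Relation.Unary.All.Properties as AllP
open import Data.List.Relation.Unary.AllPairs using ([]; _∷_)
open import Data.List.Relation.Unary.Any using (here; there; _─_)
open import Data.List.Relation.Unary.Unique.Propositional using (Unique)
import Data.List.Relation.Unary.Unique.Propositional.Properties as Unique
open import Data.Nat
  using (ℕ; zero; suc; _+_; _*_; _^_; _∸_; _/_; _%_; _≤_; _<_; _≤?_; z≤n; s≤s; NonZero; >-nonZero)
open import Data.Nat.DivMod using (m/n*n≤m; m/n≤m; m%n<n; m≡m%n+[m/n]*n; m*n/n≡m; /-monoˡ-≤)
open import Data.Nat.ListAction using (sum)
open import Data.Nat.ListAction.Properties using (sum-++)
open import Data.Nat.Properties
  using (≤-refl; ≤-trans; ≤-reflexive; +-mono-≤; *-monoʳ-≤; *-monoˡ-≤; module ≤-Reasoning)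
import Data.Nat.Properties as ℕP
import Data.Nat.Tactic.RingSolver as ℕSolver
open import Data.Product using (Σ; ∃; _×_; _,_; proj₁; proj₂)
open import Data.Vec as Vec using (Vec; []; _∷_)
import Data.Vec.Properties as VecP
open import Data.Vec.Relation.Unary.All as VecAll using ([]; _∷_)
open import Function using (id; _∘_)
open import Relation.Binary.PropositionalEquality as ≡
  using (_≡_; _≢_; refl; cong; cong₂; subst; module ≡-Reasoning)
open import Relation.Nullary using (yes; no)

open import Algebra.Properties.CommutativeSemigroup ℕP.+-commutativeSemigroup
  using () renaming (interchange to +-interchange; x∙yz≈y∙xz to x+[y+z]≡y+[x+z])
open import Algebra.Properties.Semiring.Sum ℕP.+-*-semiring
  using (sum-syntax; ∑-distrib-+; *-distribˡ-sum; sum-cong-≗; sum-replicate-zero)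

m≤m*m : ∀ m → m ≤ m * m
m≤m*m zero    = z≤n
m≤m*m (suc m) = ℕP.m≤m*n (suc m) (suc m)

^-distribʳ-* : ∀ m n o → (m * n) ^ o ≡ m ^ o * n ^ o
^-distribʳ-* m n zero    = refl
^-distribʳ-* m n (suc o) = ≡.trans (cong (m * n *_) (^-distribʳ-* m n o)) (interchange m n _ _)
  where
  interchange : ∀ a b c d → a * b * (c * d) ≡ a * c * (b * d)
  interchange = ℕSolver.solve-∀

-- Finite sums of natural numbers

∑≤n*c : ∀ {n c} (f : Fin n → ℕ) → (∀ i → f i ≤ c) → ∑[ i < n ] f i ≤ n * c
∑≤n*c {zero}  f f≤c = z≤n
∑≤n*c {suc n} f f≤c = +-mono-≤ (f≤c zero) (∑≤n*c (f ∘ suc) (f≤c ∘ suc))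

∑ₗ : {A : Set} → List A → (A → ℕ) → ℕ
∑ₗ xs f = sum (map f xs)

syntax ∑ₗ xs (λ x → e) = ∑[ x ∈ xs ] e

∑-cong : {A : Set} {f g : A → ℕ} (xs : List A) → (∀ x → f x ≡ g x) → ∑ₗ xs f ≡ ∑ₗ xs g
∑-cong xs f≗g = cong sum (ListP.map-cong f≗g xs)

∑-mono : {A : Set} {f g : A → ℕ} {xs : List A} → All (λ x → f x ≤ g x) xs → ∑ₗ xs f ≤ ∑ₗ xs g
∑-mono []           = z≤n
∑-mono (fx≤gx ∷ le) = +-mono-≤ fx≤gx (∑-mono le)

∑-++ : {A : Set} (xs ys : List A) (f : A → ℕ) → ∑ₗ (xs ++ ys) f ≡ ∑ₗ xs f + ∑ₗ ys f
∑-++ xs ys f = ≡.trans (cong sum (ListP.map-++ f xs ys)) (sum-++ (map f xs) (map f ys))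

∑-map : {A B : Set} (g : A → B) (xs : List A) (f : B → ℕ) → ∑ₗ (map g xs) f ≡ ∑ₗ xs (f ∘ g)
∑-map g xs f = cong sum (≡.sym (ListP.map-∘ xs))

∑-+ : {A : Set} (xs : List A) (f g : A → ℕ) → ∑[ x ∈ xs ] (f x + g x) ≡ ∑ₗ xs f + ∑ₗ xs g
∑-+ []       f g = refl
∑-+ (x ∷ xs) f g =
  ≡.trans (cong (_+_ (f x + g x)) (∑-+ xs f g)) (+-interchange (f x) (g x) _ _)

∑-*ˡ : {A : Set} (c : ℕ) (xs : List A) (f : A → ℕ) → ∑[ x ∈ xs ] (c * f x) ≡ c * ∑ₗ xs f
∑-*ˡ c []       f = ≡.sym (ℕP.*-zeroʳ c)
∑-*ˡ c (x ∷ xs) f =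
  ≡.trans (cong (_+_ (c * f x)) (∑-*ˡ c xs f)) (≡.sym (ℕP.*-distribˡ-+ c (f x) _))

∑-*ʳ : {A : Set} (c : ℕ) (xs : List A) (f : A → ℕ) → ∑[ x ∈ xs ] (f x * c) ≡ ∑ₗ xs f * c
∑-*ʳ c []       f = refl
∑-*ʳ c (x ∷ xs) f =
  ≡.trans (cong (_+_ (f x * c)) (∑-*ʳ c xs f)) (≡.sym (ℕP.*-distribʳ-+ c (f x) _))

∑-const : {A : Set} (c : ℕ) (xs : List A) → ∑[ _ ∈ xs ] c ≡ length xs * c
∑-const c []       = refl
∑-const c (x ∷ xs) = cong (_+_ c) (∑-const c xs)

∑-cartesianProductWith : {A B C : Set} (h : A → B → C) (xs : List A) (ys : List B) (f : C → ℕ) →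
  ∑ₗ (cartesianProductWith h xs ys) f ≡ ∑[ x ∈ xs ] ∑ₗ ys (f ∘ h x)
∑-cartesianProductWith h []       ys f = refl
∑-cartesianProductWith h (x ∷ xs) ys f = begin
  ∑ₗ (map (h x) ys ++ cartesianProductWith h xs ys) f
    ≡⟨ ∑-++ (map (h x) ys) _ f ⟩
  ∑ₗ (map (h x) ys) f + ∑ₗ (cartesianProductWith h xs ys) f
    ≡⟨ cong₂ _+_ (∑-map (h x) ys f) (∑-cartesianProductWith h xs ys f) ⟩
  ∑ₗ ys (f ∘ h x) + ∑[ x′ ∈ xs ] ∑ₗ ys (f ∘ h x′) ∎
  where open ≡-Reasoning

∑-─ : {A : Set} {x : A} (f : A → ℕ) (ys : List A) (x∈ys : x ∈ₚ ys) →
  ∑ₗ ys f ≡ f x + ∑ₗ (ys ─ x∈ys) f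
∑-─ f (y ∷ ys) (here refl)  = refl
∑-─ f (y ∷ ys) (there x∈ys) =
  ≡.trans (cong (_+_ (f y)) (∑-─ f ys x∈ys)) (x+[y+z]≡y+[x+z] (f y) (f _) _)

∈-─ : {A : Set} {x z : A} {ys : List A} (x∈ys : x ∈ₚ ys) → z ∈ₚ ys → z ≢ x → z ∈ₚ (ys ─ x∈ys)
∈-─ (here refl)  (here refl)  z≢x = ⊥-elim (z≢x refl)
∈-─ (here refl)  (there z∈ys) z≢x = z∈ys
∈-─ (there x∈ys) (here refl)  z≢x = here refl
∈-─ (there x∈ys) (there z∈ys) z≢x = there (∈-─ x∈ys z∈ys z≢x)

unique∧⊆⇒∑≤ : {A : Set} (f : A → ℕ) {xs ys : List A} →
  Unique xs → All (_∈ₚ ys) xs → ∑ₗ xs f ≤ ∑ₗ ys f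
unique∧⊆⇒∑≤ f []                  []               = z≤n
unique∧⊆⇒∑≤ f {x ∷ xs} {ys} (x≢xs ∷ uniq) (x∈ys ∷ xs⊆ys) = begin
  f x + ∑ₗ xs f            ≤⟨ ℕP.+-monoʳ-≤ (f x) (unique∧⊆⇒∑≤ f uniq xs⊆ys─x) ⟩
  f x + ∑ₗ (ys ─ x∈ys) f   ≡⟨ ∑-─ f ys x∈ys ⟨
  ∑ₗ ys f                  ∎
  where
  open ≤-Reasoning
  xs⊆ys─x : All (_∈ₚ (ys ─ x∈ys)) xs
  xs⊆ys─x = All.zipWith (λ (x≢z , z∈ys) → ∈-─ x∈ys z∈ys (x≢z ∘ ≡.sym)) (x≢xs , xs⊆ys)

markov : {A : Set} (f : A → ℕ) (B : ℕ) (xs : List A) →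
  length xs * suc B ≤ ∑ₗ xs f + suc B * length (filter (λ x → f x ≤? B) xs)
markov f B []       = z≤n
markov f B (x ∷ xs) with f x ≤? B
... | yes fx≤B rewrite ListP.filter-accept (λ y → f y ≤? B) {xs = xs} fx≤B = begin
  suc B + length xs * suc B       ≤⟨ ℕP.+-monoʳ-≤ (suc B) (markov f B xs) ⟩
  suc B + (S + suc B * l)         ≤⟨ ℕP.m≤n+m _ (f x) ⟩
  f x + (suc B + (S + suc B * l)) ≡⟨ regroup (f x) B S l ⟩
  f x + S + suc B * suc l         ∎
  where
  open ≤-Reasoning
  S = ∑ₗ xs f
  l = length (filter (λ x → f x ≤? B) xs)
  regroup : ∀ a B S l → a + (suc B + (S + suc B * l)) ≡ a + S + suc B * suc l
  regroup = ℕSolver.solve-∀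
... | no fx≰B rewrite ListP.filter-reject (λ y → f y ≤? B) {xs = xs} fx≰B = begin
  suc B + length xs * suc B ≤⟨ +-mono-≤ (ℕP.≰⇒> fx≰B) (markov f B xs) ⟩
  f x + (S + suc B * l)     ≡⟨ ℕP.+-assoc (f x) S _ ⟨
  f x + S + suc B * l       ∎
  where
  open ≤-Reasoning
  S = ∑ₗ xs f
  l = length (filter (λ x → f x ≤? B) xs)

∑2^<2^ : ∀ n → ∑[ e ∈ downFrom n ] (2 ^ e) < 2 ^ n
∑2^<2^ zero    = s≤s z≤n
∑2^<2^ (suc n) = begin-strict
  2 ^ n + ∑[ e ∈ downFrom n ] (2 ^ e) <⟨ ℕP.+-monoʳ-< (2 ^ n) (∑2^<2^ n) ⟩
  2 ^ n + 2 ^ n                       ≡⟨ cong (_+_ (2 ^ n)) (ℕP.+-identityʳ (2 ^ n)) ⟨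
  2 ^ suc n                           ∎
  where open ≤-Reasoning

vectorsOver : {A : Set} → List A → (n : ℕ) → List (Vec A n)
vectorsOver xs zero    = [] ∷ []
vectorsOver xs (suc n) = cartesianProductWith _∷_ xs (vectorsOver xs n)

vectorsOver⁺ : {A : Set} {xs : List A} → Unique xs → ∀ n → Unique (vectorsOver xs n)
vectorsOver⁺ u zero    = [] ∷ []
vectorsOver⁺ u (suc n) = Unique.cartesianProductWith⁺ _∷_ VecP.∷-injective u (vectorsOver⁺ u n)

∈-vectorsOver : {A : Set} {xs : List A} {n : ℕ} {v : Vec A n} →
  VecAll.All (_∈ₚ xs) v → v ∈ₚ vectorsOver xs n
∈-vectorsOver []          = here refl
∈-vectorsOver (a∈xs ∷ v∈) = ∈-cartesianProductWith⁺ _∷_ a∈xs (∈-vectorsOver v∈)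

∏ : {A : Set} {n : ℕ} → (A → ℕ) → Vec A n → ℕ
∏ u []      = 1
∏ u (a ∷ v) = u a * ∏ u v

∑∏-vectorsOver : {A : Set} (xs : List A) (u : A → ℕ) (n : ℕ) →
  ∑[ v ∈ vectorsOver xs n ] ∏ u v ≡ ∑ₗ xs u ^ n
∑∏-vectorsOver xs u zero    = refl
∑∏-vectorsOver xs u (suc n) = begin
  ∑ₗ (cartesianProductWith _∷_ xs V) (∏ u) ≡⟨ ∑-cartesianProductWith _∷_ xs V (∏ u) ⟩
  ∑[ a ∈ xs ] ∑[ v ∈ V ] (u a * ∏ u v)     ≡⟨ ∑-cong xs (λ a → ∑-*ˡ (u a) V (∏ u)) ⟩
  ∑[ a ∈ xs ] (u a * ∑ₗ V (∏ u))           ≡⟨ ∑-*ʳ _ xs u ⟩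
  ∑ₗ xs u * ∑ₗ V (∏ u)                     ≡⟨ cong (∑ₗ xs u *_) (∑∏-vectorsOver xs u n) ⟩
  ∑ₗ xs u * ∑ₗ xs u ^ n                    ∎
  where
  open ≡-Reasoning
  V = vectorsOver xs n

length-vectorsOver : {A : Set} (xs : List A) (n : ℕ) → length (vectorsOver xs n) ≡ length xs ^ n
length-vectorsOver xs n = begin
  length V                  ≡⟨ length≡∑1 V ⟩
  ∑[ _ ∈ V ] 1              ≡⟨ ∑-cong V ∏1≡1 ⟨
  ∑[ v ∈ V ] ∏ (λ _ → 1) v  ≡⟨ ∑∏-vectorsOver xs (λ _ → 1) n ⟩
  (∑[ _ ∈ xs ] 1) ^ n       ≡⟨ cong (_^ n) (length≡∑1 xs) ⟨
  length xs ^ n             ∎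
  where
  open ≡-Reasoning
  V = vectorsOver xs n
  length≡∑1 : {B : Set} (ys : List B) → length ys ≡ ∑[ _ ∈ ys ] 1
  length≡∑1 ys = ≡.sym (≡.trans (∑-const 1 ys) (ℕP.*-identityʳ (length ys)))
  ∏1≡1 : ∀ {m} (v : Vec _ m) → ∏ (λ _ → 1) v ≡ 1
  ∏1≡1 []      = refl
  ∏1≡1 (_ ∷ v) = ≡.trans (ℕP.+-identityʳ _) (∏1≡1 v)

-- Dissociated sign matrices

module ℤ∑ = CommutativeMonoidSum ℤP.+-0-commutativeMonoid

toℤ : Sign → ℤ
toℤ neg = -1ℤ
toℤ zer = 0ℤ
toℤ pos = 1ℤ

-ˢ_ : Sign → Sign
-ˢ neg = pos
-ˢ zer = zer
-ˢ pos = neg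

_·ˢ_ : Sign → Sign → Sign
neg ·ˢ e = -ˢ e
zer ·ˢ e = zer
pos ·ˢ e = e

toℤ-·ˢ : ∀ t e → toℤ (t ·ˢ e) ≡ toℤ t ℤ.* toℤ e
toℤ-·ˢ neg neg = refl
toℤ-·ˢ neg zer = refl
toℤ-·ˢ neg pos = refl
toℤ-·ˢ zer neg = refl
toℤ-·ˢ zer zer = refl
toℤ-·ˢ zer pos = refl
toℤ-·ˢ pos neg = refl
toℤ-·ˢ pos zer = refl
toℤ-·ˢ pos pos = refl

pos# neg# : Sign → ℕ
pos# pos = 1
pos# _   = 0
neg# neg = 1
neg# _   = 0

toℤ≡pos#-neg# : ∀ e → toℤ e ≡ + pos# e ℤ.- + neg# e
toℤ≡pos#-neg# neg = refl
toℤ≡pos#-neg# zer = refl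
toℤ≡pos#-neg# pos = refl

∑toℤ≡∑pos#-∑neg# : ∀ {n} (t : Fin n → Sign) →
  ℤ∑.sum (toℤ ∘ t) ≡ + ∑[ i < n ] pos# (t i) ℤ.- + ∑[ i < n ] neg# (t i)
∑toℤ≡∑pos#-∑neg# {zero}  t = refl
∑toℤ≡∑pos#-∑neg# {suc n} t = begin
  toℤ (t zero) ℤ.+ ℤ∑.sum (toℤ ∘ t ∘ suc)
    ≡⟨ cong₂ ℤ._+_ (toℤ≡pos#-neg# (t zero)) (∑toℤ≡∑pos#-∑neg# (t ∘ suc)) ⟩
  (+ p ℤ.- + m) ℤ.+ (+ P ℤ.- + M)
    ≡⟨ differences-+ (+ p) (+ m) (+ P) (+ M) ⟩
  (+ p ℤ.+ + P) ℤ.- (+ m ℤ.+ + M)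
    ≡⟨ cong₂ ℤ._-_ (ℤP.pos-+ p P) (ℤP.pos-+ m M) ⟨
  + (p + P) ℤ.- + (m + M) ∎
  where
  open ≡-Reasoning
  p = pos# (t zero)
  m = neg# (t zero)
  P = ∑[ i < n ] pos# (t (suc i))
  M = ∑[ i < n ] neg# (t (suc i))
  differences-+ : ∀ a b c d → (a ℤ.- b) ℤ.+ (c ℤ.- d) ≡ (a ℤ.+ c) ℤ.- (b ℤ.+ d)
  differences-+ = ℤSolver.solve-∀

SignMatrix : ℕ → ℕ → Set
SignMatrix d s = Fin d → Fin s → Sign

DissociatedRows : ∀ {d s} → SignMatrix d s → Set
DissociatedRows {d} {s} E = (c : Fin d → Sign) →
  (∀ j → ℤ∑.sum (λ i → toℤ (c i) ℤ.* toℤ (E i j)) ≡ 0ℤ) → ∀ i → c i ≡ zer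

module _ {c ℓ : Level} (G : AbelianGroup c ℓ) where

  open AbelianGroup G renaming (Carrier to El; refl to ≈-refl; sym to ≈-sym; trans to ≈-trans)
  open AdditiveSets G
  open import Algebra.Properties.AbelianGroup G using (ε⁻¹≈ε; ⁻¹-involutive; ⁻¹-∙-comm)
  open import Algebra.Properties.CommutativeSemigroup commutativeSemigroup using (interchange)
  open import Algebra.Properties.CommutativeMonoid.Sum commutativeMonoid
    using (∑-comm; sum-cong-≋) renaming (sum to ∑ᴳ; sum-replicate-zero to ∑ᴳ-replicate-ε)
  open import Algebra.Properties.Monoid.Mult monoid using (×-homo-+) renaming (_×_ to _·_)
  open import Relation.Binary.Reasoning.Setoid setoid

  act-cong : ∀ e {x y} → x ≈ y → act e x ≈ act e y
  act-cong neg = ⁻¹-cong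
  act-cong zer = λ _ → ≈-refl
  act-cong pos = id

  act-act : ∀ t e x → act t (act e x) ≈ act (t ·ˢ e) x
  act-act neg neg x = ⁻¹-involutive x
  act-act neg zer x = ε⁻¹≈ε
  act-act neg pos x = ≈-refl
  act-act zer e   x = ≈-refl
  act-act pos e   x = ≈-refl

  act-∑ : ∀ e {n} (f : Fin n → El) → act e (∑ᴳ f) ≈ ∑ᴳ (act e ∘ f)
  act-∑ neg {zero}  f = ε⁻¹≈ε
  act-∑ neg {suc n} f = ≈-trans (≈-sym (⁻¹-∙-comm _ _)) (∙-congˡ (act-∑ neg (f ∘ suc)))
  act-∑ zer {n}     f = ≈-sym (∑ᴳ-replicate-ε n)
  act-∑ pos         f = ≈-refl

  signedSum≈∑ : ∀ xs e → signedSum xs e ≈ ∑ᴳ (λ i → act (e i) (lookup xs i))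
  signedSum≈∑ []       e = ≈-refl
  signedSum≈∑ (x ∷ xs) e = ∙-congˡ (signedSum≈∑ xs (e ∘ suc))

  act≈pos#·-neg#· : ∀ e x → act e x ≈ pos# e · x ∙ (neg# e · x) ⁻¹
  act≈pos#·-neg#· neg x = ≈-sym (≈-trans (identityˡ _) (⁻¹-cong (identityʳ x)))
  act≈pos#·-neg#· zer x = ≈-sym (inverseʳ ε)
  act≈pos#·-neg#· pos x = ≈-sym (≈-trans (∙-congˡ ε⁻¹≈ε) (≈-trans (identityʳ _) (identityʳ x)))

  ∑act≈∑pos#·-∑neg#· : ∀ {n} (t : Fin n → Sign) x →
    ∑ᴳ (λ i → act (t i) x) ≈ (∑[ i < n ] pos# (t i)) · x ∙ ((∑[ i < n ] neg# (t i)) · x) ⁻¹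
  ∑act≈∑pos#·-∑neg#· {zero}  t x = ≈-sym (inverseʳ ε)
  ∑act≈∑pos#·-∑neg#· {suc n} t x = begin
    act (t zero) x ∙ ∑ᴳ (λ i → act (t (suc i)) x)
      ≈⟨ ∙-cong (act≈pos#·-neg#· (t zero) x) (∑act≈∑pos#·-∑neg#· (t ∘ suc) x) ⟩
    (p · x ∙ (m · x) ⁻¹) ∙ (P · x ∙ (M · x) ⁻¹)
      ≈⟨ ≈-trans (interchange _ _ _ _) (∙-congˡ (⁻¹-∙-comm _ _)) ⟩
    (p · x ∙ P · x) ∙ (m · x ∙ M · x) ⁻¹
      ≈⟨ ∙-cong (×-homo-+ x p P) (⁻¹-cong (×-homo-+ x m M)) ⟨
    (p + P) · x ∙ ((m + M) · x) ⁻¹ ∎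
    where
    p = pos# (t zero)
    m = neg# (t zero)
    P = ∑[ i < n ] pos# (t (suc i))
    M = ∑[ i < n ] neg# (t (suc i))

  ∑act≈ε : ∀ {n} (t : Fin n → Sign) x → ℤ∑.sum (toℤ ∘ t) ≡ 0ℤ → ∑ᴳ (λ i → act (t i) x) ≈ ε
  ∑act≈ε {n} t x ∑t≡0 = begin
    ∑ᴳ (λ i → act (t i) x)  ≈⟨ ∑act≈∑pos#·-∑neg#· t x ⟩
    P · x ∙ (M · x) ⁻¹      ≈⟨ ∙-congˡ (⁻¹-cong (reflexive (cong (_· x) P≡M))) ⟨
    P · x ∙ (P · x) ⁻¹      ≈⟨ inverseʳ _ ⟩
    ε                       ∎
    where
    P = ∑[ i < n ] pos# (t i)
    M = ∑[ i < n ] neg# (t i)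
    P≡M : P ≡ M
    P≡M = ℤP.+-injective (ℤP.i-j≡0⇒i≡j _ _ (≡.trans (≡.sym (∑toℤ≡∑pos#-∑neg# t)) ∑t≡0))

  dissociated⇒dissociatedRows : ∀ {A S D} → D ⊆ A → Dissociated D → Spans S A →
    ∃ (DissociatedRows {length D} {length S})
  dissociated⇒dissociatedRows {A} {S} {D} D⊆A dissD ⟨S⟩⊇A = E , dissE
    where
    d = length D
    s = length S
    inSpan : (i : Fin d) → InSpan S (lookup D i)
    inSpan i with (e , Se≈y) , x≈y ← All.lookupAny ⟨S⟩⊇A (All.lookup D⊆A (∈-lookup i)) =
      e , ≈-trans Se≈y (≈-sym x≈y)
    E : SignMatrix d s
    E i = proj₁ (inSpan i)
    dissE : DissociatedRows E
    dissE c columns≡0 = dissD c (begin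
      signedSum D c
        ≈⟨ signedSum≈∑ D c ⟩
      ∑ᴳ (λ i → act (c i) (lookup D i))
        ≈⟨ sum-cong-≋ {d} (λ i → act-cong (c i) (≈-sym (proj₂ (inSpan i)))) ⟩
      ∑ᴳ (λ i → act (c i) (signedSum S (E i)))
        ≈⟨ sum-cong-≋ {d} (λ i → act-cong (c i) (signedSum≈∑ S (E i))) ⟩
      ∑ᴳ (λ i → act (c i) (∑ᴳ (λ j → act (E i j) (lookup S j))))
        ≈⟨ sum-cong-≋ {d} (λ i → act-∑ (c i) (λ j → act (E i j) (lookup S j))) ⟩
      ∑ᴳ (λ i → ∑ᴳ (λ j → act (c i) (act (E i j) (lookup S j))))
        ≈⟨ sum-cong-≋ {d} (λ i → sum-cong-≋ {s} (λ j → act-act (c i) (E i j) (lookup S j))) ⟩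
      ∑ᴳ (λ i → ∑ᴳ (λ j → act (c i ·ˢ E i j) (lookup S j)))
        ≈⟨ ∑-comm (λ i j → act (c i ·ˢ E i j) (lookup S j)) ⟩
      ∑ᴳ (λ j → ∑ᴳ (λ i → act (c i ·ˢ E i j) (lookup S j)))
        ≈⟨ sum-cong-≋ {s} (λ j → ∑act≈ε (λ i → c i ·ˢ E i j) (lookup S j) (column≡0 j)) ⟩
      ∑ᴳ {s} (λ _ → ε)
        ≈⟨ ∑ᴳ-replicate-ε s ⟩
      ε ∎)
      where
      column≡0 : ∀ j → ℤ∑.sum (λ i → toℤ (c i ·ˢ E i j)) ≡ 0ℤ
      column≡0 j = ≡.trans (ℤ∑.sum-cong-≗ (λ i → toℤ-·ˢ (c i) (E i j))) (columns≡0 j)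

-- Signed sums of the rows of a sign matrix

signs : List Bool
signs = true ∷ false ∷ []

sgn : Bool → ℤ
sgn true  = 1ℤ
sgn false = -1ℤ

signVectors : (d : ℕ) → List (Vec Bool d)
signVectors = vectorsOver signs

length-signVectors : ∀ d → length (signVectors d) ≡ 2 ^ d
length-signVectors = length-vectorsOver signs

combination : ∀ {d s} → SignMatrix d s → Vec Bool d → Fin s → ℤ
combination E []      j = 0ℤ
combination E (b ∷ ε) j = sgn b ℤ.* toℤ (E zero j) ℤ.+ combination (E ∘ suc) ε j

∣_∣² : ℤ → ℕ
∣ k ∣² = ℤ.∣ k ∣ * ℤ.∣ k ∣

‖_‖² : ∀ {s} → (Fin s → ℤ) → ℕ
‖_‖² {s} x = ∑[ j < s ] ∣ x j ∣²

+∣k∣²≡k*k : ∀ k → + ∣ k ∣² ≡ k ℤ.* k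
+∣k∣²≡k*k (+ n)      = ℤP.pos-* n n
+∣k∣²≡k*k ℤ.-[1+ n ] = refl

parallelogram : ∀ x g → ∣ 1ℤ ℤ.* x ℤ.+ g ∣² + ∣ -1ℤ ℤ.* x ℤ.+ g ∣² ≡ 2 * (∣ x ∣² + ∣ g ∣²)
parallelogram x g = ℤP.+-injective (begin
  + (∣ u ∣² + ∣ v ∣²)              ≡⟨ ℤP.pos-+ ∣ u ∣² ∣ v ∣² ⟩
  + ∣ u ∣² ℤ.+ + ∣ v ∣²            ≡⟨ cong₂ ℤ._+_ (+∣k∣²≡k*k u) (+∣k∣²≡k*k v) ⟩
  u ℤ.* u ℤ.+ v ℤ.* v              ≡⟨ squares x g ⟩
  + 2 ℤ.* (x ℤ.* x ℤ.+ g ℤ.* g)    ≡⟨ cong (+ 2 ℤ.*_) (cong₂ ℤ._+_ (+∣k∣²≡k*k x) (+∣k∣²≡k*k g)) ⟨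
  + 2 ℤ.* (+ ∣ x ∣² ℤ.+ + ∣ g ∣²)  ≡⟨ cong (+ 2 ℤ.*_) (ℤP.pos-+ ∣ x ∣² ∣ g ∣²) ⟨
  + 2 ℤ.* + (∣ x ∣² + ∣ g ∣²)      ≡⟨ ℤP.pos-* 2 (∣ x ∣² + ∣ g ∣²) ⟨
  + (2 * (∣ x ∣² + ∣ g ∣²))        ∎)
  where
  open ≡-Reasoning
  u = 1ℤ ℤ.* x ℤ.+ g
  v = -1ℤ ℤ.* x ℤ.+ g
  squares : ∀ x g →
    (1ℤ ℤ.* x ℤ.+ g) ℤ.* (1ℤ ℤ.* x ℤ.+ g) ℤ.+ (-1ℤ ℤ.* x ℤ.+ g) ℤ.* (-1ℤ ℤ.* x ℤ.+ g)
      ≡ + 2 ℤ.* (x ℤ.* x ℤ.+ g ℤ.* g)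
  squares = ℤSolver.solve-∀

‖combination‖²-parallelogram : ∀ {d s} (E : SignMatrix (suc d) s) ε →
  ‖ combination E (true ∷ ε) ‖² + ‖ combination E (false ∷ ε) ‖²
    ≡ 2 * (‖ toℤ ∘ E zero ‖² + ‖ combination (E ∘ suc) ε ‖²)
‖combination‖²-parallelogram {s = s} E ε = begin
  ‖ combination E (true ∷ ε) ‖² + ‖ combination E (false ∷ ε) ‖²
    ≡⟨ ∑-distrib-+ (λ j → ∣ 1ℤ ℤ.* x j ℤ.+ g j ∣²) (λ j → ∣ -1ℤ ℤ.* x j ℤ.+ g j ∣²) ⟨
  ∑[ j < s ] (∣ 1ℤ ℤ.* x j ℤ.+ g j ∣² + ∣ -1ℤ ℤ.* x j ℤ.+ g j ∣²)
    ≡⟨ sum-cong-≗ (λ j → parallelogram (x j) (g j)) ⟩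
  ∑[ j < s ] (2 * (∣ x j ∣² + ∣ g j ∣²))
    ≡⟨ *-distribˡ-sum 2 (λ j → ∣ x j ∣² + ∣ g j ∣²) ⟨
  2 * ∑[ j < s ] (∣ x j ∣² + ∣ g j ∣²)
    ≡⟨ cong (2 *_) (∑-distrib-+ (λ j → ∣ x j ∣²) (λ j → ∣ g j ∣²)) ⟩
  2 * (‖ x ‖² + ‖ g ‖²) ∎
  where
  open ≡-Reasoning
  x = toℤ ∘ E zero
  g = combination (E ∘ suc) ε

∑‖combination‖² : ∀ {d s} (E : SignMatrix d s) →
  ∑[ ε ∈ signVectors d ] ‖ combination E ε ‖² ≡ 2 ^ d * ∑[ i < d ] ‖ toℤ ∘ E i ‖²
∑‖combination‖² {zero}  {s} E = ≡.trans (ℕP.+-identityʳ _) (sum-replicate-zero s)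
∑‖combination‖² {suc d} {s} E = begin
  ∑ₗ (cartesianProductWith _∷_ signs V) f
    ≡⟨ ∑-cartesianProductWith _∷_ signs V f ⟩
  ∑[ ε ∈ V ] f (true ∷ ε) + (∑[ ε ∈ V ] f (false ∷ ε) + 0)
    ≡⟨ cong (_+_ (∑[ ε ∈ V ] f (true ∷ ε))) (ℕP.+-identityʳ _) ⟩
  ∑[ ε ∈ V ] f (true ∷ ε) + ∑[ ε ∈ V ] f (false ∷ ε)
    ≡⟨ ∑-+ V (λ ε → f (true ∷ ε)) (λ ε → f (false ∷ ε)) ⟨
  ∑[ ε ∈ V ] (f (true ∷ ε) + f (false ∷ ε))
    ≡⟨ ∑-cong V (‖combination‖²-parallelogram E) ⟩
  ∑[ ε ∈ V ] (2 * (R₀ + f′ ε))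
    ≡⟨ ∑-*ˡ 2 V (λ ε → R₀ + f′ ε) ⟩
  2 * ∑[ ε ∈ V ] (R₀ + f′ ε)
    ≡⟨ cong (2 *_) (∑-+ V (λ _ → R₀) f′) ⟩
  2 * (∑[ _ ∈ V ] R₀ + ∑ₗ V f′)
    ≡⟨ cong (λ t → 2 * (t + ∑ₗ V f′)) (∑-const R₀ V) ⟩
  2 * (length V * R₀ + ∑ₗ V f′)
    ≡⟨ cong₂ (λ l t → 2 * (l * R₀ + t)) (length-signVectors d) (∑‖combination‖² (E ∘ suc)) ⟩
  2 * (2 ^ d * R₀ + 2 ^ d * R′)
    ≡⟨ cong (2 *_) (ℕP.*-distribˡ-+ (2 ^ d) R₀ R′) ⟨
  2 * (2 ^ d * (R₀ + R′))
    ≡⟨ ℕP.*-assoc 2 (2 ^ d) _ ⟨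
  2 ^ suc d * (R₀ + R′) ∎
  where
  open ≡-Reasoning
  V = signVectors d
  f = λ ε → ‖ combination E ε ‖²
  f′ = λ ε → ‖ combination (E ∘ suc) ε ‖²
  R₀ = ‖ toℤ ∘ E zero ‖²
  R′ = ∑[ i < d ] ‖ toℤ ∘ E (suc i) ‖²

∣toℤ∣²≤1 : ∀ e → ∣ toℤ e ∣² ≤ 1
∣toℤ∣²≤1 neg = ≤-refl
∣toℤ∣²≤1 zer = z≤n
∣toℤ∣²≤1 pos = ≤-refl

∑‖row‖²≤d*s : ∀ {d s} (E : SignMatrix d s) → ∑[ i < d ] ‖ toℤ ∘ E i ‖² ≤ d * s
∑‖row‖²≤d*s {s = s} E = ∑≤n*c _ (λ i →
  ≤-trans (∑≤n*c _ (λ j → ∣toℤ∣²≤1 (E i j))) (≤-reflexive (ℕP.*-identityʳ s)))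

halfDifference : Bool → Bool → Sign
halfDifference true  false = pos
halfDifference false true  = neg
halfDifference _     _     = zer

sgn-difference : ∀ b b′ → sgn b ℤ.- sgn b′ ≡ + 2 ℤ.* toℤ (halfDifference b b′)
sgn-difference true  true  = refl
sgn-difference true  false = refl
sgn-difference false true  = refl
sgn-difference false false = refl

halfDifference≡zer⇒≡ : ∀ {b b′} → halfDifference b b′ ≡ zer → b ≡ b′
halfDifference≡zer⇒≡ {true}  {true}  _ = refl
halfDifference≡zer⇒≡ {false} {false} _ = refl

halfDifferences : ∀ {d} → Vec Bool d → Vec Bool d → Fin d → Sign
halfDifferences ε ε′ i = halfDifference (Vec.lookup ε i) (Vec.lookup ε′ i)

combination-difference : ∀ {d s} (E : SignMatrix d s) ε ε′ j →
  combination E ε j ℤ.- combination E ε′ j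
    ≡ + 2 ℤ.* ℤ∑.sum (λ i → toℤ (halfDifferences ε ε′ i) ℤ.* toℤ (E i j))
combination-difference E []      []        j = refl
combination-difference E (b ∷ ε) (b′ ∷ ε′) j = begin
  (sgn b ℤ.* e ℤ.+ g) ℤ.- (sgn b′ ℤ.* e ℤ.+ g′)   ≡⟨ regroup (sgn b) (sgn b′) e g g′ ⟩
  (sgn b ℤ.- sgn b′) ℤ.* e ℤ.+ (g ℤ.- g′)         ≡⟨ cong₂ (λ p q → p ℤ.* e ℤ.+ q)
                                                       (sgn-difference b b′)
                                                       (combination-difference (E ∘ suc) ε ε′ j) ⟩
  + 2 ℤ.* δ ℤ.* e ℤ.+ + 2 ℤ.* R                  ≡⟨ factor δ e R ⟩
  + 2 ℤ.* (δ ℤ.* e ℤ.+ R)                         ∎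
  where
  open ≡-Reasoning
  e = toℤ (E zero j)
  g = combination (E ∘ suc) ε j
  g′ = combination (E ∘ suc) ε′ j
  δ = toℤ (halfDifference b b′)
  R = ℤ∑.sum (λ i → toℤ (halfDifferences ε ε′ i) ℤ.* toℤ (E (suc i) j))
  regroup : ∀ p p′ e g g′ → (p ℤ.* e ℤ.+ g) ℤ.- (p′ ℤ.* e ℤ.+ g′) ≡ (p ℤ.- p′) ℤ.* e ℤ.+ (g ℤ.- g′)
  regroup = ℤSolver.solve-∀
  factor : ∀ δ e R → + 2 ℤ.* δ ℤ.* e ℤ.+ + 2 ℤ.* R ≡ + 2 ℤ.* (δ ℤ.* e ℤ.+ R)
  factor = ℤSolver.solve-∀

combination-injective : ∀ {d s} {E : SignMatrix d s} → DissociatedRows E →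
  ∀ {ε ε′} → (∀ j → combination E ε j ≡ combination E ε′ j) → ε ≡ ε′
combination-injective {E = E} dissE {ε} {ε′} same = begin
  ε                             ≡⟨ VecP.tabulate∘lookup ε ⟨
  Vec.tabulate (Vec.lookup ε)   ≡⟨ VecP.tabulate-cong (λ i → halfDifference≡zer⇒≡ (δ≡zer i)) ⟩
  Vec.tabulate (Vec.lookup ε′)  ≡⟨ VecP.tabulate∘lookup ε′ ⟩
  ε′                            ∎
  where
  open ≡-Reasoning
  column≡0 : ∀ j → ℤ∑.sum (λ i → toℤ (halfDifferences ε ε′ i) ℤ.* toℤ (E i j)) ≡ 0ℤ
  column≡0 j = ℤP.*-cancelˡ-≡ (+ 2) _ 0ℤ (begin
    + 2 ℤ.* _                                   ≡⟨ combination-difference E ε ε′ j ⟨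
    combination E ε j ℤ.- combination E ε′ j    ≡⟨ cong (ℤ._- combination E ε′ j) (same j) ⟩
    combination E ε′ j ℤ.- combination E ε′ j   ≡⟨ ℤP.+-inverseʳ (combination E ε′ j) ⟩
    0ℤ                                          ∎)
  δ≡zer : ∀ i → halfDifferences ε ε′ i ≡ zer
  δ≡zer = dissE (halfDifferences ε ε′) column≡0

point : ∀ {d s} → SignMatrix d s → Vec Bool d → Vec ℤ s
point E ε = Vec.tabulate (combination E ε)

point-injective : ∀ {d s} {E : SignMatrix d s} → DissociatedRows E →
  ∀ {ε ε′} → point E ε ≡ point E ε′ → ε ≡ ε′
point-injective {E = E} dissE {ε} {ε′} pε≡pε′ = combination-injective dissE λ j → begin
  combination E ε j          ≡⟨ VecP.lookup∘tabulate (combination E ε) j ⟨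
  Vec.lookup (point E ε) j   ≡⟨ cong (λ v → Vec.lookup v j) pε≡pε′ ⟩
  Vec.lookup (point E ε′) j  ≡⟨ VecP.lookup∘tabulate (combination E ε′) j ⟩
  combination E ε′ j         ∎
  where open ≡-Reasoning

‖point‖²≡‖combination‖² : ∀ {d s} (E : SignMatrix d s) ε →
  ‖ Vec.lookup (point E ε) ‖² ≡ ‖ combination E ε ‖²
‖point‖²≡‖combination‖² E ε =
  sum-cong-≗ (λ j → cong ∣_∣² (VecP.lookup∘tabulate (combination E ε) j))

shortSigns : ∀ {d s} → SignMatrix d s → List (Vec Bool d)
shortSigns {d} {s} E = filter (λ ε → ‖ combination E ε ‖² ≤? 2 * (d * s)) (signVectors d)

2^d≤2*∣shortSigns∣ : ∀ {d s} (E : SignMatrix d s) → 2 ^ d ≤ 2 * length (shortSigns E)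
2^d≤2*∣shortSigns∣ {d} {s} E = markov⇒half (2 ^ d) (d * s) (length (shortSigns E)) (begin
  2 ^ d * suc B                                   ≡⟨ cong (_* suc B) (length-signVectors d) ⟨
  length V * suc B                                ≤⟨ markov f B V ⟩
  ∑ₗ V f + suc B * length (shortSigns E)          ≤⟨ +-mono-≤ moment≤ ≤-refl ⟩
  2 ^ d * (d * s) + suc B * length (shortSigns E) ∎)
  where
  open ≤-Reasoning
  V = signVectors d
  B = 2 * (d * s)
  f = λ ε → ‖ combination E ε ‖²
  moment≤ : ∑ₗ V f ≤ 2 ^ d * (d * s)
  moment≤ = ≤-trans (≤-reflexive (∑‖combination‖² E)) (*-monoʳ-≤ (2 ^ d) (∑‖row‖²≤d*s E))
  markov⇒half : ∀ p m g → p * suc (2 * m) ≤ p * m + suc (2 * m) * g → p ≤ 2 * g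
  markov⇒half p m g hyp = ℕP.*-cancelʳ-≤ p (2 * g) (suc m) (ℕP.+-cancelˡ-≤ (p * m) _ _ (begin
    p * m + p * suc m              ≡⟨ split p m ⟩
    p * suc (2 * m)                ≤⟨ hyp ⟩
    p * m + suc (2 * m) * g        ≤⟨ ℕP.+-monoʳ-≤ (p * m) (*-monoˡ-≤ g (ℕP.n≤1+n (suc (2 * m)))) ⟩
    p * m + suc (suc (2 * m)) * g  ≡⟨ cong (_+_ (p * m)) (double g m) ⟩
    p * m + 2 * g * suc m          ∎))
    where
    split : ∀ p m → p * m + p * suc m ≡ p * suc (2 * m)
    split = ℕSolver.solve-∀
    double : ∀ g m → suc (suc (2 * m)) * g ≡ 2 * g * suc m
    double = ℕSolver.solve-∀

-- Lattice points in a ball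

-- weight k stands for 2^A · 2^(-⌊|k|/r⌋), scaled by 2^A to stay in ℕ; the truncation in A ∸ _
-- never happens on the box below.
module LatticeWeights (r : ℕ) .{{_ : NonZero r}} (A : ℕ) where

  level : ℤ → ℕ
  level k = ℤ.∣ k ∣ / r

  weight : ℤ → ℕ
  weight k = 2 ^ (A ∸ level k)

  ∑levels ∑levels² : ∀ {s} → Vec ℤ s → ℕ
  ∑levels  = Vec.sum ∘ Vec.map level
  ∑levels² = Vec.sum ∘ Vec.map (λ k → level k * level k)

  2^A^s≤2^∑levels*∏weight : ∀ {s} (x : Vec ℤ s) → (2 ^ A) ^ s ≤ 2 ^ ∑levels x * ∏ weight x
  2^A^s≤2^∑levels*∏weight []              = ≤-refl
  2^A^s≤2^∑levels*∏weight {suc s} (k ∷ x) = begin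
    2 ^ A * (2 ^ A) ^ s
      ≤⟨ ℕP.*-mono-≤ 2^A≤ (2^A^s≤2^∑levels*∏weight x) ⟩
    (2 ^ level k * weight k) * (2 ^ ∑levels x * ∏ weight x)
      ≡⟨ interchange (2 ^ level k) (weight k) _ _ ⟩
    (2 ^ level k * 2 ^ ∑levels x) * (weight k * ∏ weight x)
      ≡⟨ cong (_* ∏ weight (k ∷ x)) (ℕP.^-distribˡ-+-* 2 (level k) (∑levels x)) ⟨
    2 ^ ∑levels (k ∷ x) * ∏ weight (k ∷ x) ∎
    where
    open ≤-Reasoning
    2^A≤ : 2 ^ A ≤ 2 ^ level k * weight k
    2^A≤ = ≤-trans (ℕP.^-monoʳ-≤ 2 (ℕP.m≤n+m∸n A (level k)))
                   (≤-reflexive (ℕP.^-distribˡ-+-* 2 (level k) (A ∸ level k)))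
    interchange : ∀ a b c d → a * b * (c * d) ≡ a * c * (b * d)
    interchange = ℕSolver.solve-∀

  r*r*∑levels²≤‖x‖² : ∀ {s} (x : Vec ℤ s) → r * r * ∑levels² x ≤ ‖ Vec.lookup x ‖²
  r*r*∑levels²≤‖x‖² []      = ≤-reflexive (ℕP.*-zeroʳ (r * r))
  r*r*∑levels²≤‖x‖² (k ∷ x) = begin
    r * r * (level k * level k + ∑levels² x)         ≡⟨ ℕP.*-distribˡ-+ (r * r) _ _ ⟩
    r * r * (level k * level k) + r * r * ∑levels² x ≤⟨ +-mono-≤ square≤ (r*r*∑levels²≤‖x‖² x) ⟩
    ∣ k ∣² + ‖ Vec.lookup x ‖²                       ∎
    where
    open ≤-Reasoning
    square≤ : r * r * (level k * level k) ≤ ∣ k ∣²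
    square≤ = begin
      r * r * (level k * level k)    ≡⟨ rearrange r (level k) ⟩
      (level k * r) * (level k * r)  ≤⟨ ℕP.*-mono-≤ (m/n*n≤m ℤ.∣ k ∣ r) (m/n*n≤m ℤ.∣ k ∣ r) ⟩
      ∣ k ∣²                         ∎
      where
      rearrange : ∀ r l → r * r * (l * l) ≡ (l * r) * (l * r)
      rearrange = ℕSolver.solve-∀

  ∑levels≤∑levels² : ∀ {s} (x : Vec ℤ s) → ∑levels x ≤ ∑levels² x
  ∑levels≤∑levels² []      = z≤n
  ∑levels≤∑levels² (k ∷ x) = +-mono-≤ (m≤m*m (level k)) (∑levels≤∑levels² x)

  ball⇒2^A^s≤4^s*∏weight : ∀ {s} (x : Vec ℤ s) → ‖ Vec.lookup x ‖² ≤ 2 * (r * r * s) →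
    (2 ^ A) ^ s ≤ 4 ^ s * ∏ weight x
  ball⇒2^A^s≤4^s*∏weight {s} x x∈ball = begin
    (2 ^ A) ^ s                 ≤⟨ 2^A^s≤2^∑levels*∏weight x ⟩
    2 ^ ∑levels x * ∏ weight x  ≤⟨ *-monoˡ-≤ (∏ weight x) (ℕP.^-monoʳ-≤ 2 ∑levels≤2s) ⟩
    2 ^ (2 * s) * ∏ weight x    ≡⟨ cong (_* ∏ weight x) (ℕP.^-*-assoc 2 2 s) ⟨
    4 ^ s * ∏ weight x          ∎
    where
    open ≤-Reasoning
    ∑levels≤2s : ∑levels x ≤ 2 * s
    ∑levels≤2s = ≤-trans (∑levels≤∑levels² x) (ℕP.*-cancelˡ-≤ (r * r) {{ℕP.m*n≢0 r r}} (begin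
      r * r * ∑levels² x  ≤⟨ r*r*∑levels²≤‖x‖² x ⟩
      ‖ Vec.lookup x ‖²   ≤⟨ x∈ball ⟩
      2 * (r * r * s)     ≡⟨ swap (r * r) s ⟩
      r * r * (2 * s)     ∎))
      where
      swap : ∀ q s → 2 * (q * s) ≡ q * (2 * s)
      swap = ℕSolver.solve-∀

  -- The numbers 0, …, (A+1)r - 1 in blocks of length r, block e being those n with
  -- ⌊n/r⌋ = A ∸ e, on which the weight is at most 2^e.
  magnitudes : List ℕ
  magnitudes = cartesianProductWith (λ e o → o + (A ∸ e) * r) (downFrom (suc A)) (upTo r)

  signed : Bool → ℕ → ℤ
  signed true  n = + n
  signed false n = ℤ.- (+ n)

  box : List ℤ
  box = cartesianProductWith signed signs magnitudes

  ∈-magnitudes : ∀ {n} → n ≤ A → n ∈ₚ magnitudes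
  ∈-magnitudes {n} n≤A = subst (_∈ₚ magnitudes) n≡ (∈-cartesianProductWith⁺ _
    (∈-downFrom⁺ (s≤s (ℕP.m∸n≤m A (n / r)))) (∈-upTo⁺ (m%n<n n r)))
    where
    n≡ : n % r + (A ∸ (A ∸ n / r)) * r ≡ n
    n≡ = ≡.trans (cong (λ q → n % r + q * r) (ℕP.m∸[m∸n]≡n (≤-trans (m/n≤m n r) n≤A)))
                 (≡.sym (m≡m%n+[m/n]*n n r))

  ∈-box : ∀ k → ℤ.∣ k ∣ ≤ A → k ∈ₚ box
  ∈-box (+ n)      n≤A =
    ∈-cartesianProductWith⁺ signed {xs = signs} (here refl) (∈-magnitudes n≤A)
  ∈-box ℤ.-[1+ n ] n≤A =
    ∈-cartesianProductWith⁺ signed {xs = signs} (there (here refl)) (∈-magnitudes n≤A)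

  weight-signed : ∀ b n → weight (signed b n) ≡ weight (+ n)
  weight-signed true  n = refl
  weight-signed false n = cong (λ m → 2 ^ (A ∸ m / r)) (ℤP.∣-i∣≡∣i∣ (+ n))

  ∑weight-magnitudes : ∑[ n ∈ magnitudes ] weight (+ n) ≤ r * 2 ^ suc A
  ∑weight-magnitudes = begin
    ∑[ n ∈ magnitudes ] weight (+ n)
      ≡⟨ ∑-cartesianProductWith _ (downFrom (suc A)) (upTo r) (weight ∘ +_) ⟩
    ∑[ e ∈ downFrom (suc A) ] ∑[ o ∈ upTo r ] weight (+ (o + (A ∸ e) * r))
      ≤⟨ ∑-mono (All.tabulate λ e∈ → ∑-mono (All.universal (weight≤ (e≤A e∈)) (upTo r))) ⟩
    ∑[ e ∈ downFrom (suc A) ] ∑[ _ ∈ upTo r ] (2 ^ e)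
      ≡⟨ ∑-cong (downFrom (suc A)) (λ e → ∑-const (2 ^ e) (upTo r)) ⟩
    ∑[ e ∈ downFrom (suc A) ] (length (upTo r) * 2 ^ e)
      ≡⟨ ∑-*ˡ (length (upTo r)) (downFrom (suc A)) (2 ^_) ⟩
    length (upTo r) * ∑[ e ∈ downFrom (suc A) ] (2 ^ e)
      ≤⟨ ℕP.*-mono-≤ (≤-reflexive (ListP.length-upTo r)) (ℕP.<⇒≤ (∑2^<2^ (suc A))) ⟩
    r * 2 ^ suc A ∎
    where
    open ≤-Reasoning
    e≤A : ∀ {e} → e ∈ₚ downFrom (suc A) → e ≤ A
    e≤A = ℕP.≤-pred ∘ ∈-downFrom⁻
    weight≤ : ∀ {e} → e ≤ A → ∀ o → weight (+ (o + (A ∸ e) * r)) ≤ 2 ^ e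
    weight≤ {e} e≤A o = ℕP.^-monoʳ-≤ 2 (begin
      A ∸ (o + (A ∸ e) * r) / r  ≤⟨ ℕP.∸-monoʳ-≤ A A∸e≤level ⟩
      A ∸ (A ∸ e)                ≡⟨ ℕP.m∸[m∸n]≡n e≤A ⟩
      e                          ∎)
      where
      A∸e≤level : A ∸ e ≤ (o + (A ∸ e) * r) / r
      A∸e≤level = ≤-trans (≤-reflexive (≡.sym (m*n/n≡m (A ∸ e) r))) (/-monoˡ-≤ r (ℕP.m≤n+m _ o))

  ∑weight-box : ∑ₗ box weight ≤ 4 * r * 2 ^ A
  ∑weight-box = begin
    ∑ₗ box weight
      ≡⟨ ∑-cartesianProductWith signed signs magnitudes weight ⟩
    W + (∑ₗ magnitudes (weight ∘ signed false) + 0)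
      ≡⟨ cong (_+_ W) (≡.trans (ℕP.+-identityʳ _) (∑-cong magnitudes (weight-signed false))) ⟩
    W + W
      ≤⟨ +-mono-≤ ∑weight-magnitudes ∑weight-magnitudes ⟩
    r * 2 ^ suc A + r * 2 ^ suc A
      ≡⟨ doubling r (2 ^ A) ⟩
    4 * r * 2 ^ A ∎
    where
    open ≤-Reasoning
    W = ∑[ n ∈ magnitudes ] weight (+ n)
    doubling : ∀ r p → r * (2 * p) + r * (2 * p) ≡ 4 * r * p
    doubling = ℕSolver.solve-∀

∣xᵢ∣≤‖x‖² : ∀ {s} (x : Vec ℤ s) → VecAll.All (λ k → ℤ.∣ k ∣ ≤ ‖ Vec.lookup x ‖²) x
∣xᵢ∣≤‖x‖² []      = []
∣xᵢ∣≤‖x‖² (k ∷ x) = ≤-trans (m≤m*m ℤ.∣ k ∣) (ℕP.m≤m+n ∣ k ∣² _)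
                  ∷ VecAll.map (λ le → ≤-trans le (ℕP.m≤n+m _ ∣ k ∣²)) (∣xᵢ∣≤‖x‖² x)

lattice-ball-count : ∀ r .{{_ : NonZero r}} s (xs : List (Vec ℤ s)) → Unique xs →
  All (λ x → ‖ Vec.lookup x ‖² ≤ 2 * (r * r * s)) xs → length xs ≤ (16 * r) ^ s
lattice-ball-count r s xs distinct inBall = ℕP.*-cancelʳ-≤ (length xs) ((16 * r) ^ s) ((2 ^ A) ^ s)
  {{ℕP.m^n≢0 (2 ^ A) s {{ℕP.m^n≢0 2 A}}}} (begin
    length xs * (2 ^ A) ^ s
      ≡⟨ ∑-const ((2 ^ A) ^ s) xs ⟨
    ∑[ _ ∈ xs ] ((2 ^ A) ^ s)
      ≤⟨ ∑-mono (All.map (λ {x} → ball⇒2^A^s≤4^s*∏weight x) inBall) ⟩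
    ∑[ x ∈ xs ] (4 ^ s * ∏ weight x)
      ≡⟨ ∑-*ˡ (4 ^ s) xs (∏ weight) ⟩
    4 ^ s * ∑ₗ xs (∏ weight)
      ≤⟨ *-monoʳ-≤ (4 ^ s) (unique∧⊆⇒∑≤ (∏ weight) distinct (All.map in-box inBall)) ⟩
    4 ^ s * ∑ₗ (vectorsOver box s) (∏ weight)
      ≡⟨ cong (4 ^ s *_) (∑∏-vectorsOver box weight s) ⟩
    4 ^ s * ∑ₗ box weight ^ s
      ≤⟨ *-monoʳ-≤ (4 ^ s) (ℕP.^-monoˡ-≤ s ∑weight-box) ⟩
    4 ^ s * (4 * r * 2 ^ A) ^ s
      ≡⟨ ^-distribʳ-* 4 (4 * r * 2 ^ A) s ⟨
    (4 * (4 * r * 2 ^ A)) ^ s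
      ≡⟨ cong (_^ s) (regroup r (2 ^ A)) ⟩
    (16 * r * 2 ^ A) ^ s
      ≡⟨ ^-distribʳ-* (16 * r) (2 ^ A) s ⟩
    (16 * r) ^ s * (2 ^ A) ^ s ∎)
  where
  open ≤-Reasoning
  A = 2 * (r * r * s)
  open LatticeWeights r A
  in-box : ∀ {x} → ‖ Vec.lookup x ‖² ≤ A → x ∈ₚ vectorsOver box s
  in-box {x} x∈ball =
    ∈-vectorsOver (VecAll.map (λ ∣k∣≤ → ∈-box _ (≤-trans ∣k∣≤ x∈ball)) (∣xᵢ∣≤‖x‖² x))
  regroup : ∀ r p → 4 * (4 * r * p) ≡ 16 * r * p
  regroup = ℕSolver.solve-∀

-- Sign matrices with dissociated rows have many columns

∣shortSigns∣≤[16r]^s : ∀ {d s} {E : SignMatrix d s} → DissociatedRows E →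
  ∀ r .{{_ : NonZero r}} → d ≤ r * r → length (shortSigns E) ≤ (16 * r) ^ s
∣shortSigns∣≤[16r]^s {d} {s} {E} dissE r d≤r*r = begin
  length (shortSigns E)                  ≡⟨ ListP.length-map (point E) (shortSigns E) ⟨
  length (map (point E) (shortSigns E))  ≤⟨ lattice-ball-count r s _ distinct inBall ⟩
  (16 * r) ^ s                           ∎
  where
  open ≤-Reasoning
  distinct : Unique (map (point E) (shortSigns E))
  distinct = Unique.map⁺ (point-injective dissE)
    (Unique.filter⁺ _ (vectorsOver⁺ (((λ ()) ∷ []) ∷ [] ∷ []) d))
  inBall : All (λ x → ‖ Vec.lookup x ‖² ≤ 2 * (r * r * s)) (map (point E) (shortSigns E))
  inBall = AllP.map⁺ (All.map (λ {ε} short → begin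
    ‖ Vec.lookup (point E ε) ‖²  ≡⟨ ‖point‖²≡‖combination‖² E ε ⟩
    ‖ combination E ε ‖²         ≤⟨ short ⟩
    2 * (d * s)                  ≤⟨ *-monoʳ-≤ 2 (*-monoˡ-≤ s d≤r*r) ⟩
    2 * (r * r * s)              ∎) (AllP.all-filter _ (signVectors d)))

√-bracket : ∀ n → ∃ λ r → suc n ≤ suc r * suc r × suc r * suc r ≤ 4 * suc n
√-bracket zero    = 0 , ≤-refl , s≤s z≤n
√-bracket (suc n) with √-bracket n
... | r , n<r² , r²≤4n with suc (suc n) ≤? suc r * suc r
...   | yes n+1<r² = r , n+1<r² , ≤-trans r²≤4n (*-monoʳ-≤ 4 (ℕP.n≤1+n (suc n)))
...   | no  n+1≮r² = suc r , n+1<[r+1]² , [r+1]²≤4[n+1]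
  where
  open ≤-Reasoning
  n≡r² : suc n ≡ suc r * suc r
  n≡r² = ℕP.≤-antisym n<r² (ℕP.≤-pred (ℕP.≰⇒> n+1≮r²))
  n+1<[r+1]² : suc (suc n) ≤ suc (suc r) * suc (suc r)
  n+1<[r+1]² = ≤-trans (s≤s (≤-reflexive n≡r²)) (ℕP.*-mono-< (ℕP.n<1+n (suc r)) (ℕP.n<1+n (suc r)))
  [r+1]²≤4[n+1] : suc (suc r) * suc (suc r) ≤ 4 * suc (suc n)
  [r+1]²≤4[n+1] = begin
    suc (suc r) * suc (suc r)                            ≤⟨ ℕP.m≤m+n _ (3 * r * r + 4 * r + 4) ⟩
    suc (suc r) * suc (suc r) + (3 * r * r + 4 * r + 4)  ≡⟨ expand r ⟩
    4 * suc (suc r * suc r)                              ≡⟨ cong (λ m → 4 * suc m) n≡r² ⟨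
    4 * suc (suc n)                                      ∎
    where
    expand : ∀ t → suc (suc t) * suc (suc t) + (3 * t * t + 4 * t + 4) ≡ 4 * suc (suc t * suc t)
    expand = ℕSolver.solve-∀

dissociatedRows⇒4^d≤4*[1024d]^s : ∀ {d s} {E : SignMatrix d s} .{{_ : NonZero d}} →
  DissociatedRows E → 4 ^ d ≤ 4 * (1024 * d) ^ s
dissociatedRows⇒4^d≤4*[1024d]^s {suc d} {s} {E} dissE with √-bracket d
... | r′ , d≤r² , r²≤4d = begin
  4 ^ suc d                    ≡⟨ ^-distribʳ-* 2 2 (suc d) ⟩
  2 ^ suc d * 2 ^ suc d        ≤⟨ ℕP.*-mono-≤ 2^d≤2X 2^d≤2X ⟩
  (2 * X) * (2 * X)            ≡⟨ square X ⟩
  4 * (X * X)                  ≡⟨ cong (4 *_) (^-distribʳ-* (16 * r) (16 * r) s) ⟨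
  4 * (16 * r * (16 * r)) ^ s  ≤⟨ *-monoʳ-≤ 4 (ℕP.^-monoˡ-≤ s 256r²≤1024d) ⟩
  4 * (1024 * suc d) ^ s       ∎
  where
  open ≤-Reasoning
  r = suc r′
  X = (16 * r) ^ s
  2^d≤2X : 2 ^ suc d ≤ 2 * X
  2^d≤2X = ≤-trans (2^d≤2*∣shortSigns∣ E) (*-monoʳ-≤ 2 (∣shortSigns∣≤[16r]^s dissE r d≤r²))
  square : ∀ x → (2 * x) * (2 * x) ≡ 4 * (x * x)
  square = ℕSolver.solve-∀
  256r²≤1024d : 16 * r * (16 * r) ≤ 1024 * suc d
  256r²≤1024d = begin
    16 * r * (16 * r)  ≡⟨ rearrange r ⟩
    256 * (r * r)      ≤⟨ *-monoʳ-≤ 256 r²≤4d ⟩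
    256 * (4 * suc d)  ≡⟨ ℕP.*-assoc 256 4 (suc d) ⟨
    1024 * suc d       ∎
    where
    rearrange : ∀ r → 16 * r * (16 * r) ≡ 256 * (r * r)
    rearrange = ℕSolver.solve-∀

4^[k*d]≤d^[[1+k]*s] : ∀ k d s → 2 ≤ d → 4096 ^ k ≤ d → 4 ^ d ≤ 4 * (1024 * d) ^ s →
  4 ^ (k * d) ≤ d ^ (suc k * s)
4^[k*d]≤d^[[1+k]*s] k d zero 2≤d _ 4^d≤4 =
  ⊥-elim (ℕP.<⇒≱ (ℕP.m<n+m 4 {12} (s≤s z≤n)) (≤-trans (ℕP.^-monoʳ-≤ 4 2≤d) 4^d≤4))
4^[k*d]≤d^[[1+k]*s] k d s@(suc s′) _ 4096^k≤d 4^d≤ = begin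
  4 ^ (k * d)             ≡⟨ ≡.trans (ℕP.^-*-assoc 4 d k) (cong (4 ^_) (ℕP.*-comm d k)) ⟨
  (4 ^ d) ^ k             ≤⟨ ℕP.^-monoˡ-≤ k (≤-trans 4^d≤ 4[1024d]^s≤[4096d]^s) ⟩
  ((4096 * d) ^ s) ^ k    ≡⟨ ^-comm (4096 * d) s k ⟩
  ((4096 * d) ^ k) ^ s    ≡⟨ cong (_^ s) (^-distribʳ-* 4096 d k) ⟩
  (4096 ^ k * d ^ k) ^ s  ≤⟨ ℕP.^-monoˡ-≤ s (*-monoˡ-≤ (d ^ k) 4096^k≤d) ⟩
  (d ^ suc k) ^ s         ≡⟨ ℕP.^-*-assoc d (suc k) s ⟩
  d ^ (suc k * s)         ∎
  where
  open ≤-Reasoning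
  ^-comm : ∀ m s k → (m ^ s) ^ k ≡ (m ^ k) ^ s
  ^-comm m s k = begin-equality
    (m ^ s) ^ k  ≡⟨ ℕP.^-*-assoc m s k ⟩
    m ^ (s * k)  ≡⟨ cong (m ^_) (ℕP.*-comm s k) ⟩
    m ^ (k * s)  ≡⟨ ℕP.^-*-assoc m k s ⟨
    (m ^ k) ^ s  ∎
  4[1024d]^s≤[4096d]^s : 4 * (1024 * d) ^ s ≤ (4096 * d) ^ s
  4[1024d]^s≤[4096d]^s = begin
    4 * (1024 * d) ^ s      ≤⟨ *-monoˡ-≤ ((1024 * d) ^ s) (*-monoʳ-≤ 4 (ℕP.m^n>0 4 s′)) ⟩
    4 ^ s * (1024 * d) ^ s  ≡⟨ ^-distribʳ-* 4 (1024 * d) s ⟨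
    (4 * (1024 * d)) ^ s    ≡⟨ cong (_^ s) (ℕP.*-assoc 4 1024 d) ⟨
    (4096 * d) ^ s          ∎

theorem1p4 : {c ℓ : Level} → (k : ℕ) → Σ ℕ (λ N → (G : AbelianGroup c ℓ) →
    (A : List (AbelianGroup.Carrier G)) → (d : ℕ) →
    AdditiveSets.IsDissDim G A d → 2 ≤ d → N ≤ d →
    (S : List (AbelianGroup.Carrier G)) → AdditiveSets.Spans G S A →
    4 ^ (k * d) ≤ d ^ (suc k * length S))
theorem1p4 k = 4096 ^ k , λ where
  G A _ ((D , D⊆A , dissD , refl) , _) 2≤d 4096^k≤d S ⟨S⟩⊇A →
    let E , dissE = dissociated⇒dissociatedRows G {S = S} D⊆A dissD ⟨S⟩⊇A
    in  4^[k*d]≤d^[[1+k]*s] k (length D) (length S) 2≤d 4096^k≤d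
          (dissociatedRows⇒4^d≤4*[1024d]^s {E = E} {{>-nonZero (≤-trans (s≤s z≤n) 2≤d)}} dissE)
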